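{- Let $\Gamma = x_1:A_1,\dots,x_n:A_n$ be a context, $t$ a proof-term and $A$ a proposition with $\Gamma\vdash t:A$, and let $\sigma$ be a substitution mapping each variable $x_i$ to an element of $[\![A_i]\!]$. Then $\sigma t\in[\![A]\!]$.
   Context: The $\odot$-calculus. Propositions: $A ::= \top \mid \bot \mid A \Rightarrow A \mid A \wedge A \mid A \vee A \mid A \odot A$. Proof-terms: $t ::= x \mid t \parallel u \mid * \mid \delta_\bot(t) \mid \lambda x\, t \mid t\,u \mid \langle t,u\rangle \mid \delta_\wedge(t,[x,y]u) \mid \mathrm{inl}(t) \mid \mathrm{inr}(t) \mid \delta_\vee(t,[x]u,[y]v) \mid t+u \mid \delta_\odot(t,[x]u,[y]v) \mid \delta_\odot^\parallel(t,[x]u,[y]v)$, where $\lambda x$ binds $x$, $[x,y]$ binds $x,y$, and $[x]$, $[y]$ bind $x$, $y$; $(u/x)t$ is capture-avoiding substitution. Typing rules: $\Gamma\vdash x:A$ if $x:A\in\Gamma$; from $\Gamma\vdash t:A$ and $\Gamma\vdash u:A$ infer $\Gamma\vdash t\parallel u:A$; $\Gamma\vdash *:\top$; from $\Gamma\vdash t:\bot$ infer $\Gamma\vdash\delta_\bot(t):C$; from $\Gamma,x:A\vdash t:B$ infer $\Gamma\vdash\lambda x\,t:A\Rightarrow B$; from $\Gamma\vdash t:A\Rightarrow B$ and $\Gamma\vdash u:A$ infer $\Gamma\vdash t\,u:B$; from $\Gamma\vdash t:A$, $\Gamma\vdash u:B$ infer $\Gamma\vdash\langle t,u\rangle:A\wedge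 B$; from $\Gamma\vdash t:A\wedge B$ and $\Gamma,x:A,y:B\vdash u:C$ infer $\Gamma\vdash\delta_\wedge(t,[x,y]u):C$; from $\Gamma\vdash t:A$ infer $\Gamma\vdash\mathrm{inl}(t):A\vee B$; from $\Gamma\vdash t:B$ infer $\Gamma\vdash\mathrm{inr}(t):A\vee B$; from $\Gamma\vdash t:A\vee B$, $\Gamma,x:A\vdash u:C$, $\Gamma,y:B\vdash v:C$ infer $\Gamma\vdash\delta_\vee(t,[x]u,[y]v):C$; from $\Gamma\vdash t:A$, $\Gamma\vdash u:B$ infer $\Gamma\vdash t+u:A\odot B$; from $\Gamma\vdash t:A\odot B$, $\Gamma,x:A\vdash u:C$, $\Gamma,y:B\vdash v:C$ infer both $\Gamma\vdash\delta_\odot(t,[x]u,[y]v):C$ and $\Gamma\vdash\delta_\odot^\parallel(t,[x]u,[y]v):C$. Ultra-reduction $\longrightarrow$ is the smallest contextual relation (closed under all term constructors) containing $\sigma l\to\sigma r$ for every substitution $\sigma$ and every rule $l\to r$ among: $(\lambda x\,t)\,u\to(u/x)t$; $\delta_\wedge(\langle t,u\rangle,[x,y]v)\to(t/x,u/y)v$; $\delta_\vee(\mathrm{inl}(t),[x]v,[y]w)\to(t/x)v$; $\delta_\vee(\mathrm{inr}(u),[x]v,[y]w)\to(u/y)w$; $\delta_\odot(t+u,[x]v,[y]w)\to(t/x)v$; $\delta_\odot(t+u,[x]v,[y]w)\to(u/y)w$; $\delta_\odot^\parallel(t+u,[x]v,[y]w)\to(t/x)v\parallel(u/y)w$; $(\lambda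 x\,t)\parallel(\lambda x\,u)\to\lambda x\,(t\parallel u)$; $\langle t,u\rangle\parallel\langle v,w\rangle\to\langle t\parallel v,u\parallel w\rangle$; $\delta_\vee(t\parallel u,[x]v,[y]w)\to\delta_\vee(t,[x]v,[y]w)\parallel\delta_\vee(u,[x]v,[y]w)$; $(t+u)\parallel(v+w)\to(t\parallel v)+(u\parallel w)$; $t\parallel t\to t$; $t\parallel u\to t$; $t\parallel u\to u$. $\longrightarrow^*$ is its reflexive-transitive closure; $t$ strongly terminates if there is no infinite ultra-reduction sequence from $t$. Sets $[\![A]\!]$ are defined by induction on $A$: $t\in[\![\top]\!]$ and $t\in[\![\bot]\!]$ iff $t$ strongly terminates; $t\in[\![A\Rightarrow B]\!]$ iff $t$ strongly terminates and whenever $t\longrightarrow^*\lambda x\,u$, then $(v/x)u\in[\![B]\!]$ for every $v\in[\![A]\!]$; $t\in[\![A\wedge B]\!]$ iff $t$ strongly terminates and whenever $t\longrightarrow^*\langle u,v\rangle$, then $u\in[\![A]\!]$ and $v\in[\![B]\!]$; $t\in[\![A\vee B]\!]$ iff $t$ strongly terminates, whenever $t\longrightarrow^*\mathrm{inl}(u)$ then $u\in[\![A]\!]$, and whenever $t\longrightarrow^*\mathrm{inr}(v)$ then $v\in[\![B]\!]$; $t\in[\![A\odot B]\!]$ iff $t$ strongly terminates and whenever $t\longrightarrow^* u+v$, then $u\in[\![A]\!]$ and $v\in[\![B]\!]$. -}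

module Defs where

open import Data.Nat using (ℕ; zero; suc)
open import Data.List using (List; []; _∷_)
open import Data.Product using (_×_)
open import Relation.Binary.Construct.Closure.ReflexiveTransitive using (Star)

infixr 5 _⇒_
infixr 6 _∧_ _∨_ _⊙_

data Form : Set where
  ⊤' ⊥' : Form
  _⇒_ _∧_ _∨_ _⊙_ : Form → Form → Form

-- Binding conventions:
--   lam t          : t binds one variable (index 0)
--   δ∧ t u         : u binds two variables  [x,y]u  with y = index 0, x = index 1
--   δ∨ t u v, δ⊙ t u v, δ⊙∥ t u v : u and v each bind one variable (index 0)

data Tm : Set where
  var  : ℕ → Tm
  _∥_  : Tm → Tm → Tm
  star : Tm
  δ⊥   : Tm → Tm
  lam  : Tm → Tm
  app  : Tm → Tm → Tm
  pair : Tm → Tm → Tm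
  δ∧   : Tm → Tm → Tm
  inl  : Tm → Tm
  inr  : Tm → Tm
  δ∨   : Tm → Tm → Tm → Tm
  _⊕_  : Tm → Tm → Tm
  δ⊙   : Tm → Tm → Tm → Tm
  δ⊙∥  : Tm → Tm → Tm → Tm

Ren : Set
Ren = ℕ → ℕ

Sub : Set
Sub = ℕ → Tm

ext : Ren → Ren
ext ρ zero    = zero
ext ρ (suc n) = suc (ρ n)

rename : Ren → Tm → Tm
rename ρ (var x)      = var (ρ x)
rename ρ (t ∥ u)      = rename ρ t ∥ rename ρ u
rename ρ star         = star
rename ρ (δ⊥ t)       = δ⊥ (rename ρ t)
rename ρ (lam t)      = lam (rename (ext ρ) t)
rename ρ (app t u)    = app (rename ρ t) (rename ρ u)
rename ρ (pair t u)   = pair (rename ρ t) (rename ρ u)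
rename ρ (δ∧ t u)     = δ∧ (rename ρ t) (rename (ext (ext ρ)) u)
rename ρ (inl t)      = inl (rename ρ t)
rename ρ (inr t)      = inr (rename ρ t)
rename ρ (δ∨ t u v)   = δ∨ (rename ρ t) (rename (ext ρ) u) (rename (ext ρ) v)
rename ρ (t ⊕ u)      = rename ρ t ⊕ rename ρ u
rename ρ (δ⊙ t u v)   = δ⊙ (rename ρ t) (rename (ext ρ) u) (rename (ext ρ) v)
rename ρ (δ⊙∥ t u v)  = δ⊙∥ (rename ρ t) (rename (ext ρ) u) (rename (ext ρ) v)

exts : Sub → Sub
exts σ zero    = var zero
exts σ (suc n) = rename suc (σ n)

subst : Sub → Tm → Tm
subst σ (var x)      = σ x
subst σ (t ∥ u)      = subst σ t ∥ subst σ u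
subst σ star         = star
subst σ (δ⊥ t)       = δ⊥ (subst σ t)
subst σ (lam t)      = lam (subst (exts σ) t)
subst σ (app t u)    = app (subst σ t) (subst σ u)
subst σ (pair t u)   = pair (subst σ t) (subst σ u)
subst σ (δ∧ t u)     = δ∧ (subst σ t) (subst (exts (exts σ)) u)
subst σ (inl t)      = inl (subst σ t)
subst σ (inr t)      = inr (subst σ t)
subst σ (δ∨ t u v)   = δ∨ (subst σ t) (subst (exts σ) u) (subst (exts σ) v)
subst σ (t ⊕ u)      = subst σ t ⊕ subst σ u
subst σ (δ⊙ t u v)   = δ⊙ (subst σ t) (subst (exts σ) u) (subst (exts σ) v)
subst σ (δ⊙∥ t u v)  = δ⊙∥ (subst σ t) (subst (exts σ) u) (subst (exts σ) v)

sub1 : Tm → Sub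
sub1 u zero    = u
sub1 u (suc n) = var n

_[_] : Tm → Tm → Tm
t [ u ] = subst (sub1 u) t

-- (t/x, u/y)v  where x = index 1, y = index 0
sub2 : Tm → Tm → Sub
sub2 t u zero          = u
sub2 t u (suc zero)    = t
sub2 t u (suc (suc n)) = var n

_[_,_] : Tm → Tm → Tm → Tm
v [ t , u ] = subst (sub2 t u) v

Ctx : Set
Ctx = List Form

data _∋_∶_ : Ctx → ℕ → Form → Set where
  here  : ∀ {Γ A} → (A ∷ Γ) ∋ zero ∶ A
  there : ∀ {Γ A B n} → Γ ∋ n ∶ A → (B ∷ Γ) ∋ suc n ∶ A

infix 4 _⊢_∶_

data _⊢_∶_ (Γ : Ctx) : Tm → Form → Set where
  ⊢var  : ∀ {x A} → Γ ∋ x ∶ A → Γ ⊢ var x ∶ A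
  ⊢∥    : ∀ {t u A} → Γ ⊢ t ∶ A → Γ ⊢ u ∶ A → Γ ⊢ t ∥ u ∶ A
  ⊢star : Γ ⊢ star ∶ ⊤'
  ⊢δ⊥   : ∀ {t C} → Γ ⊢ t ∶ ⊥' → Γ ⊢ δ⊥ t ∶ C
  ⊢lam  : ∀ {t A B} → (A ∷ Γ) ⊢ t ∶ B → Γ ⊢ lam t ∶ A ⇒ B
  ⊢app  : ∀ {t u A B} → Γ ⊢ t ∶ A ⇒ B → Γ ⊢ u ∶ A → Γ ⊢ app t u ∶ B
  ⊢pair : ∀ {t u A B} → Γ ⊢ t ∶ A → Γ ⊢ u ∶ B → Γ ⊢ pair t u ∶ A ∧ B
  ⊢δ∧   : ∀ {t u A B C} → Γ ⊢ t ∶ A ∧ B → (B ∷ A ∷ Γ) ⊢ u ∶ C → Γ ⊢ δ∧ t u ∶ C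
  ⊢inl  : ∀ {t A B} → Γ ⊢ t ∶ A → Γ ⊢ inl t ∶ A ∨ B
  ⊢inr  : ∀ {t A B} → Γ ⊢ t ∶ B → Γ ⊢ inr t ∶ A ∨ B
  ⊢δ∨   : ∀ {t u v A B C} → Γ ⊢ t ∶ A ∨ B → (A ∷ Γ) ⊢ u ∶ C → (B ∷ Γ) ⊢ v ∶ C
          → Γ ⊢ δ∨ t u v ∶ C
  ⊢⊕    : ∀ {t u A B} → Γ ⊢ t ∶ A → Γ ⊢ u ∶ B → Γ ⊢ t ⊕ u ∶ A ⊙ B
  ⊢δ⊙   : ∀ {t u v A B C} → Γ ⊢ t ∶ A ⊙ B → (A ∷ Γ) ⊢ u ∶ C → (B ∷ Γ) ⊢ v ∶ C
          → Γ ⊢ δ⊙ t u v ∶ C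
  ⊢δ⊙∥  : ∀ {t u v A B C} → Γ ⊢ t ∶ A ⊙ B → (A ∷ Γ) ⊢ u ∶ C → (B ∷ Γ) ⊢ v ∶ C
          → Γ ⊢ δ⊙∥ t u v ∶ C

infix 4 _↦_ _⟶_ _⟶*_

data _↦_ : Tm → Tm → Set where
  β       : ∀ {t u} → app (lam t) u ↦ t [ u ]
  β∧      : ∀ {t u v} → δ∧ (pair t u) v ↦ v [ t , u ]
  β∨l     : ∀ {t v w} → δ∨ (inl t) v w ↦ v [ t ]
  β∨r     : ∀ {u v w} → δ∨ (inr u) v w ↦ w [ u ]
  β⊙l     : ∀ {t u v w} → δ⊙ (t ⊕ u) v w ↦ v [ t ]
  β⊙r     : ∀ {t u v w} → δ⊙ (t ⊕ u) v w ↦ w [ u ]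
  β⊙∥     : ∀ {t u v w} → δ⊙∥ (t ⊕ u) v w ↦ (v [ t ]) ∥ (w [ u ])
  ∥lam    : ∀ {t u} → lam t ∥ lam u ↦ lam (t ∥ u)
  ∥pair   : ∀ {t u v w} → pair t u ∥ pair v w ↦ pair (t ∥ v) (u ∥ w)
  ∥δ∨     : ∀ {t u v w} → δ∨ (t ∥ u) v w ↦ δ∨ t v w ∥ δ∨ u v w
  ∥⊕      : ∀ {t u v w} → (t ⊕ u) ∥ (v ⊕ w) ↦ (t ∥ v) ⊕ (u ∥ w)
  ∥idem   : ∀ {t} → t ∥ t ↦ t
  ∥l      : ∀ {t u} → t ∥ u ↦ t
  ∥r      : ∀ {t u} → t ∥ u ↦ u

data _⟶_ : Tm → Tm → Set where
  root  : ∀ {t t'} → t ↦ t' → t ⟶ t'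
  ∥₁    : ∀ {t t' u} → t ⟶ t' → t ∥ u ⟶ t' ∥ u
  ∥₂    : ∀ {t u u'} → u ⟶ u' → t ∥ u ⟶ t ∥ u'
  δ⊥₁   : ∀ {t t'} → t ⟶ t' → δ⊥ t ⟶ δ⊥ t'
  lam₁  : ∀ {t t'} → t ⟶ t' → lam t ⟶ lam t'
  app₁  : ∀ {t t' u} → t ⟶ t' → app t u ⟶ app t' u
  app₂  : ∀ {t u u'} → u ⟶ u' → app t u ⟶ app t u'
  pair₁ : ∀ {t t' u} → t ⟶ t' → pair t u ⟶ pair t' u
  pair₂ : ∀ {t u u'} → u ⟶ u' → pair t u ⟶ pair t u'
  δ∧₁   : ∀ {t t' u} → t ⟶ t' → δ∧ t u ⟶ δ∧ t' u
  δ∧₂   : ∀ {t u u'} → u ⟶ u' → δ∧ t u ⟶ δ∧ t u'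
  inl₁  : ∀ {t t'} → t ⟶ t' → inl t ⟶ inl t'
  inr₁  : ∀ {t t'} → t ⟶ t' → inr t ⟶ inr t'
  δ∨₁   : ∀ {t t' u v} → t ⟶ t' → δ∨ t u v ⟶ δ∨ t' u v
  δ∨₂   : ∀ {t u u' v} → u ⟶ u' → δ∨ t u v ⟶ δ∨ t u' v
  δ∨₃   : ∀ {t u v v'} → v ⟶ v' → δ∨ t u v ⟶ δ∨ t u v'
  ⊕₁    : ∀ {t t' u} → t ⟶ t' → t ⊕ u ⟶ t' ⊕ u
  ⊕₂    : ∀ {t u u'} → u ⟶ u' → t ⊕ u ⟶ t ⊕ u'
  δ⊙₁   : ∀ {t t' u v} → t ⟶ t' → δ⊙ t u v ⟶ δ⊙ t' u v
  δ⊙₂   : ∀ {t u u' v} → u ⟶ u' → δ⊙ t u v ⟶ δ⊙ t u' v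
  δ⊙₃   : ∀ {t u v v'} → v ⟶ v' → δ⊙ t u v ⟶ δ⊙ t u v'
  δ⊙∥₁  : ∀ {t t' u v} → t ⟶ t' → δ⊙∥ t u v ⟶ δ⊙∥ t' u v
  δ⊙∥₂  : ∀ {t u u' v} → u ⟶ u' → δ⊙∥ t u v ⟶ δ⊙∥ t u' v
  δ⊙∥₃  : ∀ {t u v v'} → v ⟶ v' → δ⊙∥ t u v ⟶ δ⊙∥ t u v'

_⟶*_ : Tm → Tm → Set
_⟶*_ = Star _⟶_

data SN (t : Tm) : Set where
  sn : (∀ {u} → t ⟶ u → SN u) → SN t

⟦_⟧ : Form → Tm → Set
⟦ ⊤' ⟧    t = SN t
⟦ ⊥' ⟧    t = SN t
⟦ A ⇒ B ⟧ t = SN t × (∀ {u} → t ⟶* lam u → ∀ v → ⟦ A ⟧ v → ⟦ B ⟧ (u [ v ]))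
⟦ A ∧ B ⟧ t = SN t × (∀ {u v} → t ⟶* pair u v → ⟦ A ⟧ u × ⟦ B ⟧ v)
⟦ A ∨ B ⟧ t = SN t × (∀ {u} → t ⟶* inl u → ⟦ A ⟧ u)
                   × (∀ {v} → t ⟶* inr v → ⟦ B ⟧ v)
⟦ A ⊙ B ⟧ t = SN t × (∀ {u v} → t ⟶* (u ⊕ v) → ⟦ A ⟧ u × ⟦ B ⟧ v)

-- Girard-style reducibility. Each ⟦ A ⟧ contains only strongly terminating
-- terms, is closed under reduction, and contains every neutral term whose
-- one-step reducts all lie in it; so each typing rule preserves reducibility
-- of substitution instances, by induction on the strong termination of the
-- immediate subterms. What is new is closure under t ∥ u: its reducts
-- include t and u themselves and, because ∥ is pushed inside lam, pairs and
-- sums, parallel compositions of their immediate subterms, so strong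
-- termination of t ∥ u is proved by induction on reduction and on those
-- subterms together.

module Submission where

open import Defs
open import Data.Nat using (zero; suc)
open import Data.List using (_∷_)
open import Data.Product using (∃; _×_; _,_; proj₁; proj₂)
open import Data.Empty using (⊥; ⊥-elim)
open import Data.Unit using (⊤; tt)
open import Function using (_∘_; id; case_of_)
open import Relation.Nullary using (¬_)
open import Relation.Binary.Construct.Closure.ReflexiveTransitive using (Star; ε; _◅_)
open import Relation.Binary.PropositionalEquality as ≡ using (_≡_; _≗_; refl; sym; trans; cong; cong₂)
open import Induction.WellFounded using (Acc; acc)

cong₃ : ∀ {A B C D : Set} (f : A → B → C → D) {a a' b b' c c'}
      → a ≡ a' → b ≡ b' → c ≡ c' → f a b c ≡ f a' b' c'
cong₃ f refl refl refl = refl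

ext-∘ : ∀ {ρ ρ' θ : Ren} → ρ ∘ ρ' ≗ θ → ext ρ ∘ ext ρ' ≗ ext θ
ext-∘ h zero    = refl
ext-∘ h (suc x) = cong suc (h x)

rename-rename : ∀ {ρ ρ' θ : Ren} → ρ ∘ ρ' ≗ θ → rename ρ ∘ rename ρ' ≗ rename θ
rename-rename h (var x)     = cong var (h x)
rename-rename h (t ∥ u)     = cong₂ _∥_ (rename-rename h t) (rename-rename h u)
rename-rename h star        = refl
rename-rename h (δ⊥ t)      = cong δ⊥ (rename-rename h t)
rename-rename h (lam t)     = cong lam (rename-rename (ext-∘ h) t)
rename-rename h (app t u)   = cong₂ app (rename-rename h t) (rename-rename h u)
rename-rename h (pair t u)  = cong₂ pair (rename-rename h t) (rename-rename h u)
rename-rename h (δ∧ t u)    = cong₂ δ∧ (rename-rename h t) (rename-rename (ext-∘ (ext-∘ h)) u)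
rename-rename h (inl t)     = cong inl (rename-rename h t)
rename-rename h (inr t)     = cong inr (rename-rename h t)
rename-rename h (δ∨ t u v)  = cong₃ δ∨ (rename-rename h t) (rename-rename (ext-∘ h) u) (rename-rename (ext-∘ h) v)
rename-rename h (t ⊕ u)     = cong₂ _⊕_ (rename-rename h t) (rename-rename h u)
rename-rename h (δ⊙ t u v)  = cong₃ δ⊙ (rename-rename h t) (rename-rename (ext-∘ h) u) (rename-rename (ext-∘ h) v)
rename-rename h (δ⊙∥ t u v) = cong₃ δ⊙∥ (rename-rename h t) (rename-rename (ext-∘ h) u) (rename-rename (ext-∘ h) v)

ext-rename-exts : ∀ {ρ : Ren} {σ τ : Sub} → rename ρ ∘ σ ≗ τ → rename (ext ρ) ∘ exts σ ≗ exts τ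
ext-rename-exts h zero    = refl
ext-rename-exts {ρ} {σ} h (suc x) = begin
  rename (ext ρ) (rename suc (σ x)) ≡⟨ rename-rename (λ _ → refl) (σ x) ⟩
  rename (suc ∘ ρ) (σ x)            ≡⟨ sym (rename-rename (λ _ → refl) (σ x)) ⟩
  rename suc (rename ρ (σ x))       ≡⟨ cong (rename suc) (h x) ⟩
  rename suc _                      ∎
  where open ≡.≡-Reasoning

rename-subst : ∀ {ρ : Ren} {σ τ : Sub} → rename ρ ∘ σ ≗ τ → rename ρ ∘ subst σ ≗ subst τ
rename-subst h (var x)     = h x
rename-subst h (t ∥ u)     = cong₂ _∥_ (rename-subst h t) (rename-subst h u)
rename-subst h star        = refl
rename-subst h (δ⊥ t)      = cong δ⊥ (rename-subst h t)
rename-subst h (lam t)     = cong lam (rename-subst (ext-rename-exts h) t)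
rename-subst h (app t u)   = cong₂ app (rename-subst h t) (rename-subst h u)
rename-subst h (pair t u)  = cong₂ pair (rename-subst h t) (rename-subst h u)
rename-subst h (δ∧ t u)    = cong₂ δ∧ (rename-subst h t) (rename-subst (ext-rename-exts (ext-rename-exts h)) u)
rename-subst h (inl t)     = cong inl (rename-subst h t)
rename-subst h (inr t)     = cong inr (rename-subst h t)
rename-subst h (δ∨ t u v)  = cong₃ δ∨ (rename-subst h t) (rename-subst (ext-rename-exts h) u) (rename-subst (ext-rename-exts h) v)
rename-subst h (t ⊕ u)     = cong₂ _⊕_ (rename-subst h t) (rename-subst h u)
rename-subst h (δ⊙ t u v)  = cong₃ δ⊙ (rename-subst h t) (rename-subst (ext-rename-exts h) u) (rename-subst (ext-rename-exts h) v)
rename-subst h (δ⊙∥ t u v) = cong₃ δ⊙∥ (rename-subst h t) (rename-subst (ext-rename-exts h) u) (rename-subst (ext-rename-exts h) v)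

exts-∘-ext : ∀ {σ τ : Sub} {ρ : Ren} → σ ∘ ρ ≗ τ → exts σ ∘ ext ρ ≗ exts τ
exts-∘-ext h zero    = refl
exts-∘-ext h (suc x) = cong (rename suc) (h x)

subst-rename : ∀ {σ τ : Sub} {ρ : Ren} → σ ∘ ρ ≗ τ → subst σ ∘ rename ρ ≗ subst τ
subst-rename h (var x)     = h x
subst-rename h (t ∥ u)     = cong₂ _∥_ (subst-rename h t) (subst-rename h u)
subst-rename h star        = refl
subst-rename h (δ⊥ t)      = cong δ⊥ (subst-rename h t)
subst-rename h (lam t)     = cong lam (subst-rename (exts-∘-ext h) t)
subst-rename h (app t u)   = cong₂ app (subst-rename h t) (subst-rename h u)
subst-rename h (pair t u)  = cong₂ pair (subst-rename h t) (subst-rename h u)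
subst-rename h (δ∧ t u)    = cong₂ δ∧ (subst-rename h t) (subst-rename (exts-∘-ext (exts-∘-ext h)) u)
subst-rename h (inl t)     = cong inl (subst-rename h t)
subst-rename h (inr t)     = cong inr (subst-rename h t)
subst-rename h (δ∨ t u v)  = cong₃ δ∨ (subst-rename h t) (subst-rename (exts-∘-ext h) u) (subst-rename (exts-∘-ext h) v)
subst-rename h (t ⊕ u)     = cong₂ _⊕_ (subst-rename h t) (subst-rename h u)
subst-rename h (δ⊙ t u v)  = cong₃ δ⊙ (subst-rename h t) (subst-rename (exts-∘-ext h) u) (subst-rename (exts-∘-ext h) v)
subst-rename h (δ⊙∥ t u v) = cong₃ δ⊙∥ (subst-rename h t) (subst-rename (exts-∘-ext h) u) (subst-rename (exts-∘-ext h) v)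

exts-subst : ∀ {τ σ θ : Sub} → subst τ ∘ σ ≗ θ → subst (exts τ) ∘ exts σ ≗ exts θ
exts-subst h zero    = refl
exts-subst {τ} {σ} h (suc x) = begin
  subst (exts τ) (rename suc (σ x)) ≡⟨ subst-rename (λ _ → refl) (σ x) ⟩
  subst (rename suc ∘ τ) (σ x)      ≡⟨ sym (rename-subst (λ _ → refl) (σ x)) ⟩
  rename suc (subst τ (σ x))        ≡⟨ cong (rename suc) (h x) ⟩
  rename suc _                      ∎
  where open ≡.≡-Reasoning

subst-subst : ∀ {τ σ θ : Sub} → subst τ ∘ σ ≗ θ → subst τ ∘ subst σ ≗ subst θ
subst-subst h (var x)     = h x
subst-subst h (t ∥ u)     = cong₂ _∥_ (subst-subst h t) (subst-subst h u)
subst-subst h star        = refl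
subst-subst h (δ⊥ t)      = cong δ⊥ (subst-subst h t)
subst-subst h (lam t)     = cong lam (subst-subst (exts-subst h) t)
subst-subst h (app t u)   = cong₂ app (subst-subst h t) (subst-subst h u)
subst-subst h (pair t u)  = cong₂ pair (subst-subst h t) (subst-subst h u)
subst-subst h (δ∧ t u)    = cong₂ δ∧ (subst-subst h t) (subst-subst (exts-subst (exts-subst h)) u)
subst-subst h (inl t)     = cong inl (subst-subst h t)
subst-subst h (inr t)     = cong inr (subst-subst h t)
subst-subst h (δ∨ t u v)  = cong₃ δ∨ (subst-subst h t) (subst-subst (exts-subst h) u) (subst-subst (exts-subst h) v)
subst-subst h (t ⊕ u)     = cong₂ _⊕_ (subst-subst h t) (subst-subst h u)
subst-subst h (δ⊙ t u v)  = cong₃ δ⊙ (subst-subst h t) (subst-subst (exts-subst h) u) (subst-subst (exts-subst h) v)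
subst-subst h (δ⊙∥ t u v) = cong₃ δ⊙∥ (subst-subst h t) (subst-subst (exts-subst h) u) (subst-subst (exts-subst h) v)

exts-var : ∀ {σ : Sub} → σ ≗ var → exts σ ≗ var
exts-var h zero    = refl
exts-var h (suc x) = cong (rename suc) (h x)

subst-id : ∀ {σ : Sub} → σ ≗ var → subst σ ≗ id
subst-id h (var x)     = h x
subst-id h (t ∥ u)     = cong₂ _∥_ (subst-id h t) (subst-id h u)
subst-id h star        = refl
subst-id h (δ⊥ t)      = cong δ⊥ (subst-id h t)
subst-id h (lam t)     = cong lam (subst-id (exts-var h) t)
subst-id h (app t u)   = cong₂ app (subst-id h t) (subst-id h u)
subst-id h (pair t u)  = cong₂ pair (subst-id h t) (subst-id h u)
subst-id h (δ∧ t u)    = cong₂ δ∧ (subst-id h t) (subst-id (exts-var (exts-var h)) u)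
subst-id h (inl t)     = cong inl (subst-id h t)
subst-id h (inr t)     = cong inr (subst-id h t)
subst-id h (δ∨ t u v)  = cong₃ δ∨ (subst-id h t) (subst-id (exts-var h) u) (subst-id (exts-var h) v)
subst-id h (t ⊕ u)     = cong₂ _⊕_ (subst-id h t) (subst-id h u)
subst-id h (δ⊙ t u v)  = cong₃ δ⊙ (subst-id h t) (subst-id (exts-var h) u) (subst-id (exts-var h) v)
subst-id h (δ⊙∥ t u v) = cong₃ δ⊙∥ (subst-id h t) (subst-id (exts-var h) u) (subst-id (exts-var h) v)

infixr 5 _•_

_•_ : Tm → Sub → Sub
(a • σ) zero    = a
(a • σ) (suc x) = σ x

subst-sub1-weaken : ∀ a t → subst (sub1 a) (rename suc t) ≡ t
subst-sub1-weaken a t = trans (subst-rename (λ _ → refl) t) (subst-id (λ _ → refl) t)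

subst-sub2-weaken : ∀ a b t → subst (sub2 a b) (rename suc t) ≡ subst (sub1 a) t
subst-sub2-weaken a b = subst-rename λ { zero → refl ; (suc _) → refl }

sub1-exts : ∀ a σ → subst (sub1 a) ∘ exts σ ≗ a • σ
sub1-exts a σ zero    = refl
sub1-exts a σ (suc x) = subst-sub1-weaken a (σ x)

sub2-exts² : ∀ a b σ → subst (sub2 a b) ∘ exts (exts σ) ≗ b • a • σ
sub2-exts² a b σ zero    = refl
sub2-exts² a b σ (suc x) = trans (subst-sub2-weaken a b (exts σ x)) (sub1-exts a σ x)

subst-exts-[] : ∀ σ a t → subst (exts σ) t [ a ] ≡ subst (a • σ) t
subst-exts-[] σ a = subst-subst (sub1-exts a σ)

subst-exts²-[,] : ∀ σ a b t → subst (sub2 a b) (subst (exts (exts σ)) t) ≡ subst (b • a • σ) t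
subst-exts²-[,] σ a b = subst-subst (sub2-exts² a b σ)

subst-[] : ∀ σ t u → subst σ (t [ u ]) ≡ subst (exts σ) t [ subst σ u ]
subst-[] σ t u = trans (subst-subst (λ { zero → refl ; (suc _) → refl }) t)
                       (sym (subst-exts-[] σ (subst σ u) t))

subst-[,] : ∀ σ t u v → subst σ (subst (sub2 t u) v) ≡ subst (sub2 (subst σ t) (subst σ u)) (subst (exts (exts σ)) v)
subst-[,] σ t u v = trans (subst-subst (λ { zero → refl ; (suc zero) → refl ; (suc (suc _)) → refl }) v)
                          (sym (subst-exts²-[,] σ (subst σ t) (subst σ u) v))

root-≡ : ∀ {l r r'} → l ↦ r → r' ≡ r → l ⟶ r'
root-≡ step refl = root step

subst-⟶ : ∀ (σ : Sub) {t t'} → t ⟶ t' → subst σ t ⟶ subst σ t'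
subst-⟶ σ (root (β {t} {u}))           = root-≡ β (subst-[] σ t u)
subst-⟶ σ (root (β∧ {t} {u} {v}))      = root-≡ β∧ (subst-[,] σ t u v)
subst-⟶ σ (root (β∨l {t} {v}))         = root-≡ β∨l (subst-[] σ v t)
subst-⟶ σ (root (β∨r {u} {v} {w}))     = root-≡ β∨r (subst-[] σ w u)
subst-⟶ σ (root (β⊙l {t} {u} {v}))     = root-≡ β⊙l (subst-[] σ v t)
subst-⟶ σ (root (β⊙r {t} {u} {v} {w})) = root-≡ β⊙r (subst-[] σ w u)
subst-⟶ σ (root (β⊙∥ {t} {u} {v} {w})) = root-≡ β⊙∥ (cong₂ _∥_ (subst-[] σ v t) (subst-[] σ w u))
subst-⟶ σ (root ∥lam)  = root ∥lam
subst-⟶ σ (root ∥pair) = root ∥pair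
subst-⟶ σ (root ∥δ∨)   = root ∥δ∨
subst-⟶ σ (root ∥⊕)    = root ∥⊕
subst-⟶ σ (root ∥idem) = root ∥idem
subst-⟶ σ (root ∥l)    = root ∥l
subst-⟶ σ (root ∥r)    = root ∥r
subst-⟶ σ (∥₁ r)   = ∥₁ (subst-⟶ σ r)
subst-⟶ σ (∥₂ r)   = ∥₂ (subst-⟶ σ r)
subst-⟶ σ (δ⊥₁ r)  = δ⊥₁ (subst-⟶ σ r)
subst-⟶ σ (lam₁ r)  = lam₁ (subst-⟶ (exts σ) r)
subst-⟶ σ (app₁ r)  = app₁ (subst-⟶ σ r)
subst-⟶ σ (app₂ r)  = app₂ (subst-⟶ σ r)
subst-⟶ σ (pair₁ r) = pair₁ (subst-⟶ σ r)
subst-⟶ σ (pair₂ r) = pair₂ (subst-⟶ σ r)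
subst-⟶ σ (δ∧₁ r)  = δ∧₁ (subst-⟶ σ r)
subst-⟶ σ (δ∧₂ r)  = δ∧₂ (subst-⟶ (exts (exts σ)) r)
subst-⟶ σ (inl₁ r)  = inl₁ (subst-⟶ σ r)
subst-⟶ σ (inr₁ r)  = inr₁ (subst-⟶ σ r)
subst-⟶ σ (δ∨₁ r)  = δ∨₁ (subst-⟶ σ r)
subst-⟶ σ (δ∨₂ r)  = δ∨₂ (subst-⟶ (exts σ) r)
subst-⟶ σ (δ∨₃ r)  = δ∨₃ (subst-⟶ (exts σ) r)
subst-⟶ σ (⊕₁ r)   = ⊕₁ (subst-⟶ σ r)
subst-⟶ σ (⊕₂ r)   = ⊕₂ (subst-⟶ σ r)
subst-⟶ σ (δ⊙₁ r)  = δ⊙₁ (subst-⟶ σ r)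
subst-⟶ σ (δ⊙₂ r)  = δ⊙₂ (subst-⟶ (exts σ) r)
subst-⟶ σ (δ⊙₃ r)  = δ⊙₃ (subst-⟶ (exts σ) r)
subst-⟶ σ (δ⊙∥₁ r) = δ⊙∥₁ (subst-⟶ σ r)
subst-⟶ σ (δ⊙∥₂ r) = δ⊙∥₂ (subst-⟶ (exts σ) r)
subst-⟶ σ (δ⊙∥₃ r) = δ⊙∥₃ (subst-⟶ (exts σ) r)

subst-⟶* : ∀ (σ : Sub) {t t'} → t ⟶* t' → subst σ t ⟶* subst σ t'
subst-⟶* σ ε        = ε
subst-⟶* σ (r ◅ rs) = subst-⟶ σ r ◅ subst-⟶* σ rs

SN-⟶ : ∀ {t t'} → SN t → t ⟶ t' → SN t'
SN-⟶ (sn f) r = f r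

SN-subst⁻¹ : ∀ (σ : Sub) {t} → SN (subst σ t) → SN t
SN-subst⁻¹ σ (sn f) = sn λ r → SN-subst⁻¹ σ (f (subst-⟶ σ r))

SN-lam : ∀ {t} → SN t → SN (lam t)
SN-lam (sn f) = sn λ { (lam₁ r) → SN-lam (f r) ; (root ()) }

SN-inl : ∀ {t} → SN t → SN (inl t)
SN-inl (sn f) = sn λ { (inl₁ r) → SN-inl (f r) ; (root ()) }

SN-inr : ∀ {t} → SN t → SN (inr t)
SN-inr (sn f) = sn λ { (inr₁ r) → SN-inr (f r) ; (root ()) }

SN-pair : ∀ {t u} → SN t → SN u → SN (pair t u)
SN-pair (sn f) (sn g) = sn λ
  { (pair₁ r) → SN-pair (f r) (sn g)
  ; (pair₂ r) → SN-pair (sn f) (g r)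
  ; (root ()) }

SN-⊕ : ∀ {t u} → SN t → SN u → SN (t ⊕ u)
SN-⊕ (sn f) (sn g) = sn λ
  { (⊕₁ r) → SN-⊕ (f r) (sn g)
  ; (⊕₂ r) → SN-⊕ (sn f) (g r)
  ; (root ()) }

infix 4 _◁_ _≺_

data _◁_ : Tm → Tm → Set where
  lam◁   : ∀ {t} → t ◁ lam t
  pair◁₁ : ∀ {t u} → t ◁ pair t u
  pair◁₂ : ∀ {t u} → u ◁ pair t u
  ⊕◁₁    : ∀ {t u} → t ◁ t ⊕ u
  ⊕◁₂    : ∀ {t u} → u ◁ t ⊕ u

◁-⟶ : ∀ {s s' t} → s ◁ t → s ⟶ s' → ∃ λ t' → t ⟶ t' × s' ◁ t'
◁-⟶ lam◁   r = _ , lam₁ r , lam◁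
◁-⟶ pair◁₁ r = _ , pair₁ r , pair◁₁
◁-⟶ pair◁₂ r = _ , pair₂ r , pair◁₂
◁-⟶ ⊕◁₁    r = _ , ⊕₁ r , ⊕◁₁
◁-⟶ ⊕◁₂    r = _ , ⊕₂ r , ⊕◁₂

◁*-⟶ : ∀ {s s' t} → Star _◁_ s t → s ⟶ s' → ∃ λ t' → t ⟶ t' × Star _◁_ s' t'
◁*-⟶ ε        r = _ , r , ε
◁*-⟶ (p ◅ ps) r with ◁-⟶ p r
... | _ , r' , p' with ◁*-⟶ ps r'
...   | _ , r'' , ps' = _ , r'' , p' ◅ ps'

-- Well founded on strongly terminating terms because ◁-steps commute with reduction (◁*-⟶).
data _≺_ : Tm → Tm → Set where
  red : ∀ {s t} → t ⟶ s → s ≺ t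
  sub : ∀ {s t} → s ◁ t → s ≺ t

SN⇒Acc : ∀ {t} → SN t → Acc _≺_ t
SN⇒Acc h = go _ h ε
  where
  go    : ∀ {t} s → SN t → Star _◁_ s t → Acc _≺_ s
  below : ∀ {t y} s → SN t → Star _◁_ s t → y ≺ s → Acc _≺_ y
  go s h p = acc (below s h p)
  -- s is matched explicitly so that termination checking sees the subterm steps decrease it
  below s (sn f) p (red r) with ◁*-⟶ p r
  ... | _ , r' , p' = go _ (f r') p'
  below (lam s)    h p (sub lam◁)   = go s h (lam◁ ◅ p)
  below (pair s _) h p (sub pair◁₁) = go s h (pair◁₁ ◅ p)
  below (pair _ s) h p (sub pair◁₂) = go s h (pair◁₂ ◅ p)
  below (s ⊕ _)    h p (sub ⊕◁₁)    = go s h (⊕◁₁ ◅ p)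
  below (_ ⊕ s)    h p (sub ⊕◁₂)    = go s h (⊕◁₂ ◅ p)

Acc⇒SN : ∀ {t} → Acc _≺_ t → SN t
Acc⇒SN (acc rs) = sn λ r → Acc⇒SN (rs (red r))

SN-∥ : ∀ {t u} → SN t → SN u → SN (t ∥ u)
SN-∥ h g = go (SN⇒Acc h) (SN⇒Acc g)
  where
  go : ∀ {t u} → Acc _≺_ t → Acc _≺_ u → SN (t ∥ u)
  go (acc rs) (acc ru) = sn λ
    { (∥₁ r)       → go (rs (red r)) (acc ru)
    ; (∥₂ r)       → go (acc rs) (ru (red r))
    ; (root ∥idem) → Acc⇒SN (acc rs)
    ; (root ∥l)    → Acc⇒SN (acc rs)
    ; (root ∥r)    → Acc⇒SN (acc ru)
    ; (root ∥lam)  → SN-lam (go (rs (sub lam◁)) (ru (sub lam◁)))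
    ; (root ∥pair) → SN-pair (go (rs (sub pair◁₁)) (ru (sub pair◁₁))) (go (rs (sub pair◁₂)) (ru (sub pair◁₂)))
    ; (root ∥⊕)    → SN-⊕ (go (rs (sub ⊕◁₁)) (ru (sub ⊕◁₁))) (go (rs (sub ⊕◁₂)) (ru (sub ⊕◁₂))) }

data Reduct₁ (c : Tm → Tm) (s : Tm) : Tm → Set where
  reduct : ∀ {s'} → s ⟶* s' → Reduct₁ c s (c s')

data Reduct₂ (c : Tm → Tm → Tm) (s t : Tm) : Tm → Set where
  reduct : ∀ {s' t'} → s ⟶* s' → t ⟶* t' → Reduct₂ c s t (c s' t')

lam-⟶* : ∀ {s X} → lam s ⟶* X → Reduct₁ lam s X
lam-⟶* ε                = reduct ε
lam-⟶* (root () ◅ _)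
lam-⟶* (lam₁ r ◅ rs) with lam-⟶* rs
... | reduct rs' = reduct (r ◅ rs')

inl-⟶* : ∀ {s X} → inl s ⟶* X → Reduct₁ inl s X
inl-⟶* ε                = reduct ε
inl-⟶* (root () ◅ _)
inl-⟶* (inl₁ r ◅ rs) with inl-⟶* rs
... | reduct rs' = reduct (r ◅ rs')

inr-⟶* : ∀ {s X} → inr s ⟶* X → Reduct₁ inr s X
inr-⟶* ε                = reduct ε
inr-⟶* (root () ◅ _)
inr-⟶* (inr₁ r ◅ rs) with inr-⟶* rs
... | reduct rs' = reduct (r ◅ rs')

pair-⟶* : ∀ {s t X} → pair s t ⟶* X → Reduct₂ pair s t X
pair-⟶* ε                 = reduct ε ε
pair-⟶* (root () ◅ _)
pair-⟶* (pair₁ r ◅ rs) with pair-⟶* rs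
... | reduct rs₁ rs₂ = reduct (r ◅ rs₁) rs₂
pair-⟶* (pair₂ r ◅ rs) with pair-⟶* rs
... | reduct rs₁ rs₂ = reduct rs₁ (r ◅ rs₂)

⊕-⟶* : ∀ {s t X} → s ⊕ t ⟶* X → Reduct₂ _⊕_ s t X
⊕-⟶* ε               = reduct ε ε
⊕-⟶* (root () ◅ _)
⊕-⟶* (⊕₁ r ◅ rs) with ⊕-⟶* rs
... | reduct rs₁ rs₂ = reduct (r ◅ rs₁) rs₂
⊕-⟶* (⊕₂ r ◅ rs) with ⊕-⟶* rs
... | reduct rs₁ rs₂ = reduct rs₁ (r ◅ rs₂)

reducible⇒SN : ∀ A {t} → ⟦ A ⟧ t → SN t
reducible⇒SN ⊤'      h = h
reducible⇒SN ⊥'      h = h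
reducible⇒SN (A ⇒ B) h = proj₁ h
reducible⇒SN (A ∧ B) h = proj₁ h
reducible⇒SN (A ∨ B) h = proj₁ h
reducible⇒SN (A ⊙ B) h = proj₁ h

reducible-⟶ : ∀ A {t t'} → ⟦ A ⟧ t → t ⟶ t' → ⟦ A ⟧ t'
reducible-⟶ ⊤'      h           r = SN-⟶ h r
reducible-⟶ ⊥'      h           r = SN-⟶ h r
reducible-⟶ (A ⇒ B) (h , k)     r = SN-⟶ h r , λ rs → k (r ◅ rs)
reducible-⟶ (A ∧ B) (h , k)     r = SN-⟶ h r , λ rs → k (r ◅ rs)
reducible-⟶ (A ∨ B) (h , k , l) r = SN-⟶ h r , (λ rs → k (r ◅ rs)) , (λ rs → l (r ◅ rs))
reducible-⟶ (A ⊙ B) (h , k)     r = SN-⟶ h r , λ rs → k (r ◅ rs)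

reducible-⟶* : ∀ A {t t'} → ⟦ A ⟧ t → t ⟶* t' → ⟦ A ⟧ t'
reducible-⟶* A h ε        = h
reducible-⟶* A h (r ◅ rs) = reducible-⟶* A (reducible-⟶ A h r) rs

Neutral : Tm → Set
Neutral (lam _)    = ⊥
Neutral (pair _ _) = ⊥
Neutral (inl _)    = ⊥
Neutral (inr _)    = ⊥
Neutral (_ ⊕ _)    = ⊥
Neutral _          = ⊤

neutral-⟶* : ∀ {t X} → Neutral t → ¬ Neutral X → t ⟶* X → ∃ λ t' → t ⟶ t' × t' ⟶* X
neutral-⟶* n ¬n ε        = ⊥-elim (¬n n)
neutral-⟶* _ _  (r ◅ rs) = _ , r , rs

reducible-neutral : ∀ A {t} → Neutral t → (∀ {t'} → t ⟶ t' → ⟦ A ⟧ t') → ⟦ A ⟧ t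
reducible-neutral ⊤'      n h = sn h
reducible-neutral ⊥'      n h = sn h
reducible-neutral (A ⇒ B) n h = sn (proj₁ ∘ h) , λ rs →
  let _ , r , rs' = neutral-⟶* n id rs in proj₂ (h r) rs'
reducible-neutral (A ∧ B) n h = sn (proj₁ ∘ h) , λ rs →
  let _ , r , rs' = neutral-⟶* n id rs in proj₂ (h r) rs'
reducible-neutral (A ∨ B) n h = sn (proj₁ ∘ h)
  , (λ rs → let _ , r , rs' = neutral-⟶* n id rs in proj₁ (proj₂ (h r)) rs')
  , (λ rs → let _ , r , rs' = neutral-⟶* n id rs in proj₂ (proj₂ (h r)) rs')
reducible-neutral (A ⊙ B) n h = sn (proj₁ ∘ h) , λ rs →
  let _ , r , rs' = neutral-⟶* n id rs in proj₂ (h r) rs'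

reducible-var : ∀ A x → ⟦ A ⟧ (var x)
reducible-var A x = reducible-neutral A tt λ { (root ()) }

Body : Form → Form → Tm → Set
Body A C u = ∀ a → ⟦ A ⟧ a → ⟦ C ⟧ (u [ a ])

Body₂ : Form → Form → Form → Tm → Set
Body₂ A B C u = ∀ a b → ⟦ A ⟧ a → ⟦ B ⟧ b → ⟦ C ⟧ (subst (sub2 a b) u)

Body-SN : ∀ A C {u} → Body A C u → SN u
Body-SN A C h = SN-subst⁻¹ (sub1 (var 0)) (reducible⇒SN C (h _ (reducible-var A 0)))

Body₂-SN : ∀ A B C {u} → Body₂ A B C u → SN u
Body₂-SN A B C h = SN-subst⁻¹ (sub2 (var 0) (var 0))
  (reducible⇒SN C (h _ _ (reducible-var A 0) (reducible-var B 0)))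

Body-⟶ : ∀ A C {u u'} → Body A C u → u ⟶ u' → Body A C u'
Body-⟶ A C h r a ha = reducible-⟶ C (h a ha) (subst-⟶ (sub1 a) r)

Body-⟶* : ∀ A C {u u'} → Body A C u → u ⟶* u' → Body A C u'
Body-⟶* A C h rs a ha = reducible-⟶* C (h a ha) (subst-⟶* (sub1 a) rs)

Body₂-⟶ : ∀ A B C {u u'} → Body₂ A B C u → u ⟶ u' → Body₂ A B C u'
Body₂-⟶ A B C h r a b ha hb = reducible-⟶ C (h a b ha hb) (subst-⟶ (sub2 a b) r)

-- The equation is vacuous unless A is an arrow, so a caller with arbitrary A discharges it by matching refl.
reducible-lam : ∀ A {s} → SN (lam s) → (∀ {B C} → A ≡ B ⇒ C → Body B C s) → ⟦ A ⟧ (lam s)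
reducible-lam ⊤'      h body = h
reducible-lam ⊥'      h body = h
reducible-lam (A ⇒ B) h body = h , λ rs → case lam-⟶* rs of λ { (reduct rs') → Body-⟶* A B (body refl) rs' }
reducible-lam (A ∧ B) h body = h , λ rs → case lam-⟶* rs of λ ()
reducible-lam (A ∨ B) h body = h , (λ rs → case lam-⟶* rs of λ ()) , (λ rs → case lam-⟶* rs of λ ())
reducible-lam (A ⊙ B) h body = h , λ rs → case lam-⟶* rs of λ ()

reducible-pair : ∀ A {t u} → SN (pair t u) → (∀ {B C} → A ≡ B ∧ C → ⟦ B ⟧ t × ⟦ C ⟧ u) → ⟦ A ⟧ (pair t u)
reducible-pair ⊤'      h hs = h
reducible-pair ⊥'      h hs = h
reducible-pair (A ⇒ B) h hs = h , λ rs → case pair-⟶* rs of λ ()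
reducible-pair (A ∧ B) h hs = h , λ rs → case pair-⟶* rs of λ
  { (reduct rs₁ rs₂) → reducible-⟶* A (proj₁ (hs refl)) rs₁ , reducible-⟶* B (proj₂ (hs refl)) rs₂ }
reducible-pair (A ∨ B) h hs = h , (λ rs → case pair-⟶* rs of λ ()) , (λ rs → case pair-⟶* rs of λ ())
reducible-pair (A ⊙ B) h hs = h , λ rs → case pair-⟶* rs of λ ()

reducible-⊕ : ∀ A {t u} → SN (t ⊕ u) → (∀ {B C} → A ≡ B ⊙ C → ⟦ B ⟧ t × ⟦ C ⟧ u) → ⟦ A ⟧ (t ⊕ u)
reducible-⊕ ⊤'      h hs = h
reducible-⊕ ⊥'      h hs = h
reducible-⊕ (A ⇒ B) h hs = h , λ rs → case ⊕-⟶* rs of λ ()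
reducible-⊕ (A ∧ B) h hs = h , λ rs → case ⊕-⟶* rs of λ ()
reducible-⊕ (A ∨ B) h hs = h , (λ rs → case ⊕-⟶* rs of λ ()) , (λ rs → case ⊕-⟶* rs of λ ())
reducible-⊕ (A ⊙ B) h hs = h , λ rs → case ⊕-⟶* rs of λ
  { (reduct rs₁ rs₂) → reducible-⟶* A (proj₁ (hs refl)) rs₁ , reducible-⟶* B (proj₂ (hs refl)) rs₂ }

reducible-⇒-lam : ∀ A B {s} → Body A B s → ⟦ A ⇒ B ⟧ (lam s)
reducible-⇒-lam A B h = reducible-lam (A ⇒ B) (SN-lam (Body-SN A B h)) λ { refl → h }

reducible-∧-pair : ∀ A B {t u} → ⟦ A ⟧ t → ⟦ B ⟧ u → ⟦ A ∧ B ⟧ (pair t u)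
reducible-∧-pair A B ht hu =
  reducible-pair (A ∧ B) (SN-pair (reducible⇒SN A ht) (reducible⇒SN B hu)) λ { refl → ht , hu }

reducible-⊙-⊕ : ∀ A B {t u} → ⟦ A ⟧ t → ⟦ B ⟧ u → ⟦ A ⊙ B ⟧ (t ⊕ u)
reducible-⊙-⊕ A B ht hu =
  reducible-⊕ (A ⊙ B) (SN-⊕ (reducible⇒SN A ht) (reducible⇒SN B hu)) λ { refl → ht , hu }

reducible-∨-inl : ∀ A B {t} → ⟦ A ⟧ t → ⟦ A ∨ B ⟧ (inl t)
reducible-∨-inl A B h = SN-inl (reducible⇒SN A h)
  , (λ rs → case inl-⟶* rs of λ { (reduct rs') → reducible-⟶* A h rs' })
  , (λ rs → case inl-⟶* rs of λ ())

reducible-∨-inr : ∀ A B {t} → ⟦ B ⟧ t → ⟦ A ∨ B ⟧ (inr t)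
reducible-∨-inr A B h = SN-inr (reducible⇒SN B h)
  , (λ rs → case inr-⟶* rs of λ ())
  , (λ rs → case inr-⟶* rs of λ { (reduct rs') → reducible-⟶* B h rs' })

reducible-∥ : ∀ A {t u} → ⟦ A ⟧ t → ⟦ A ⟧ u → ⟦ A ⟧ (t ∥ u)
reducible-∥ A ht hu = go (reducible⇒SN A ht) (reducible⇒SN A hu) ht hu
  where
  go : ∀ {t u} → SN t → SN u → ⟦ A ⟧ t → ⟦ A ⟧ u → ⟦ A ⟧ (t ∥ u)
  go (sn f) (sn g) ht hu = reducible-neutral A tt λ
    { (∥₁ r)       → go (f r) (sn g) (reducible-⟶ A ht r) hu
    ; (∥₂ r)       → go (sn f) (g r) ht (reducible-⟶ A hu r)
    ; (root ∥idem) → ht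
    ; (root ∥l)    → ht
    ; (root ∥r)    → hu
    ; (root ∥lam)  → reducible-lam A (SN-⟶ (SN-∥ (sn f) (sn g)) (root ∥lam))
        λ { {B} {C} refl v hv → reducible-∥ C (proj₂ ht ε v hv) (proj₂ hu ε v hv) }
    ; (root ∥pair) → reducible-pair A (SN-⟶ (SN-∥ (sn f) (sn g)) (root ∥pair))
        λ { {B} {C} refl → reducible-∥ B (proj₁ (proj₂ ht ε)) (proj₁ (proj₂ hu ε))
                         , reducible-∥ C (proj₂ (proj₂ ht ε)) (proj₂ (proj₂ hu ε)) }
    ; (root ∥⊕)    → reducible-⊕ A (SN-⟶ (SN-∥ (sn f) (sn g)) (root ∥⊕))
        λ { {B} {C} refl → reducible-∥ B (proj₁ (proj₂ ht ε)) (proj₁ (proj₂ hu ε))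
                         , reducible-∥ C (proj₂ (proj₂ ht ε)) (proj₂ (proj₂ hu ε)) } }

reducible-δ⊥ : ∀ C {t} → SN t → ⟦ C ⟧ (δ⊥ t)
reducible-δ⊥ C (sn f) = reducible-neutral C tt λ { (δ⊥₁ r) → reducible-δ⊥ C (f r) ; (root ()) }

reducible-app : ∀ A B {t u} → ⟦ A ⇒ B ⟧ t → ⟦ A ⟧ u → ⟦ B ⟧ (app t u)
reducible-app A B ht hu = go (proj₁ ht) (reducible⇒SN A hu) ht hu
  where
  go : ∀ {t u} → SN t → SN u → ⟦ A ⇒ B ⟧ t → ⟦ A ⟧ u → ⟦ B ⟧ (app t u)
  go (sn f) (sn g) ht hu = reducible-neutral B tt λ
    { (root β) → proj₂ ht ε _ hu
    ; (app₁ r) → go (f r) (sn g) (reducible-⟶ (A ⇒ B) ht r) hu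
    ; (app₂ r) → go (sn f) (g r) ht (reducible-⟶ A hu r) }

reducible-δ∧ : ∀ A B C {t u} → ⟦ A ∧ B ⟧ t → Body₂ A B C u → ⟦ C ⟧ (δ∧ t u)
reducible-δ∧ A B C ht hu = go (proj₁ ht) (Body₂-SN A B C hu) ht hu
  where
  go : ∀ {t u} → SN t → SN u → ⟦ A ∧ B ⟧ t → Body₂ A B C u → ⟦ C ⟧ (δ∧ t u)
  go (sn f) (sn g) ht hu = reducible-neutral C tt λ
    { (root β∧) → let ha , hb = proj₂ ht ε in hu _ _ ha hb
    ; (δ∧₁ r)   → go (f r) (sn g) (reducible-⟶ (A ∧ B) ht r) hu
    ; (δ∧₂ r)   → go (sn f) (g r) ht (Body₂-⟶ A B C hu r) }

reducible-δ∨ : ∀ A B C {t u v} → ⟦ A ∨ B ⟧ t → Body A C u → Body B C v → ⟦ C ⟧ (δ∨ t u v)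
reducible-δ∨ A B C ht hu hv = go (proj₁ ht) (Body-SN A C hu) (Body-SN B C hv) ht hu hv
  where
  go : ∀ {t u v} → SN t → SN u → SN v → ⟦ A ∨ B ⟧ t → Body A C u → Body B C v → ⟦ C ⟧ (δ∨ t u v)
  go (sn f) (sn g) (sn k) ht hu hv = reducible-neutral C tt λ
    { (root β∨l) → hu _ (proj₁ (proj₂ ht) ε)
    ; (root β∨r) → hv _ (proj₂ (proj₂ ht) ε)
    -- t₁ and t₂ are reducts of t₁ ∥ t₂ (by ∥l and ∥r), so the induction covers them
    ; (root ∥δ∨) → reducible-∥ C
        (go (f (root ∥l)) (sn g) (sn k) (reducible-⟶ (A ∨ B) ht (root ∥l)) hu hv)
        (go (f (root ∥r)) (sn g) (sn k) (reducible-⟶ (A ∨ B) ht (root ∥r)) hu hv)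
    ; (δ∨₁ r) → go (f r) (sn g) (sn k) (reducible-⟶ (A ∨ B) ht r) hu hv
    ; (δ∨₂ r) → go (sn f) (g r) (sn k) ht (Body-⟶ A C hu r) hv
    ; (δ∨₃ r) → go (sn f) (sn g) (k r) ht hu (Body-⟶ B C hv r) }

reducible-δ⊙ : ∀ A B C {t u v} → ⟦ A ⊙ B ⟧ t → Body A C u → Body B C v → ⟦ C ⟧ (δ⊙ t u v)
reducible-δ⊙ A B C ht hu hv = go (proj₁ ht) (Body-SN A C hu) (Body-SN B C hv) ht hu hv
  where
  go : ∀ {t u v} → SN t → SN u → SN v → ⟦ A ⊙ B ⟧ t → Body A C u → Body B C v → ⟦ C ⟧ (δ⊙ t u v)
  go (sn f) (sn g) (sn k) ht hu hv = reducible-neutral C tt λ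
    { (root β⊙l) → hu _ (proj₁ (proj₂ ht ε))
    ; (root β⊙r) → hv _ (proj₂ (proj₂ ht ε))
    ; (δ⊙₁ r) → go (f r) (sn g) (sn k) (reducible-⟶ (A ⊙ B) ht r) hu hv
    ; (δ⊙₂ r) → go (sn f) (g r) (sn k) ht (Body-⟶ A C hu r) hv
    ; (δ⊙₃ r) → go (sn f) (sn g) (k r) ht hu (Body-⟶ B C hv r) }

reducible-δ⊙∥ : ∀ A B C {t u v} → ⟦ A ⊙ B ⟧ t → Body A C u → Body B C v → ⟦ C ⟧ (δ⊙∥ t u v)
reducible-δ⊙∥ A B C ht hu hv = go (proj₁ ht) (Body-SN A C hu) (Body-SN B C hv) ht hu hv
  where
  go : ∀ {t u v} → SN t → SN u → SN v → ⟦ A ⊙ B ⟧ t → Body A C u → Body B C v → ⟦ C ⟧ (δ⊙∥ t u v)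
  go (sn f) (sn g) (sn k) ht hu hv = reducible-neutral C tt λ
    { (root β⊙∥) → let ha , hb = proj₂ ht ε in reducible-∥ C (hu _ ha) (hv _ hb)
    ; (δ⊙∥₁ r) → go (f r) (sn g) (sn k) (reducible-⟶ (A ⊙ B) ht r) hu hv
    ; (δ⊙∥₂ r) → go (sn f) (g r) (sn k) ht (Body-⟶ A C hu r) hv
    ; (δ⊙∥₃ r) → go (sn f) (sn g) (k r) ht hu (Body-⟶ B C hv r) }

⟦_⟧ᶜ : Ctx → Sub → Set
⟦ Γ ⟧ᶜ σ = ∀ {i B} → Γ ∋ i ∶ B → ⟦ B ⟧ (σ i)

⟦⟧ᶜ-• : ∀ {Γ A σ a} → ⟦ A ⟧ a → ⟦ Γ ⟧ᶜ σ → ⟦ A ∷ Γ ⟧ᶜ (a • σ)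
⟦⟧ᶜ-• ha env here      = ha
⟦⟧ᶜ-• ha env (there x) = env x

Body-exts : ∀ {Γ A σ} C u → ⟦ Γ ⟧ᶜ σ
          → (∀ {τ} → ⟦ A ∷ Γ ⟧ᶜ τ → ⟦ C ⟧ (subst τ u)) → Body A C (subst (exts σ) u)
Body-exts {σ = σ} C u env h a ha =
  ≡.subst ⟦ C ⟧ (sym (subst-exts-[] σ a u)) (h (⟦⟧ᶜ-• ha env))

Body₂-exts² : ∀ {Γ A B σ} C u → ⟦ Γ ⟧ᶜ σ
            → (∀ {τ} → ⟦ B ∷ A ∷ Γ ⟧ᶜ τ → ⟦ C ⟧ (subst τ u)) → Body₂ A B C (subst (exts (exts σ)) u)
Body₂-exts² {σ = σ} C u env h a b ha hb =
  ≡.subst ⟦ C ⟧ (sym (subst-exts²-[,] σ a b u)) (h (⟦⟧ᶜ-• hb (⟦⟧ᶜ-• ha env)))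

mainTheorem4 : ∀ {Γ : Ctx} {t : Tm} {A : Form} (σ : Sub)
    → Γ ⊢ t ∶ A
    → (∀ {i B} → Γ ∋ i ∶ B → ⟦ B ⟧ (σ i))
    → ⟦ A ⟧ (subst σ t)
mainTheorem4 σ (⊢var x) env = env x
mainTheorem4 σ (⊢∥ {A = A} d e) env = reducible-∥ A (mainTheorem4 σ d env) (mainTheorem4 σ e env)
mainTheorem4 σ ⊢star env = sn λ { (root ()) }
mainTheorem4 σ (⊢δ⊥ {C = C} d) env = reducible-δ⊥ C (mainTheorem4 σ d env)
mainTheorem4 σ (⊢lam {t} {A} {B} d) env = reducible-⇒-lam A B (Body-exts B t env λ {τ} → mainTheorem4 τ d)
mainTheorem4 σ (⊢app {A = A} {B} d e) env = reducible-app A B (mainTheorem4 σ d env) (mainTheorem4 σ e env)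
mainTheorem4 σ (⊢pair {A = A} {B} d e) env = reducible-∧-pair A B (mainTheorem4 σ d env) (mainTheorem4 σ e env)
mainTheorem4 σ (⊢δ∧ {u = u} {A} {B} {C} d e) env =
  reducible-δ∧ A B C (mainTheorem4 σ d env) (Body₂-exts² C u env λ {τ} → mainTheorem4 τ e)
mainTheorem4 σ (⊢inl {A = A} {B} d) env = reducible-∨-inl A B (mainTheorem4 σ d env)
mainTheorem4 σ (⊢inr {A = A} {B} d) env = reducible-∨-inr A B (mainTheorem4 σ d env)
mainTheorem4 σ (⊢δ∨ {u = u} {v} {A} {B} {C} d e f) env =
  reducible-δ∨ A B C (mainTheorem4 σ d env) (Body-exts C u env λ {τ} → mainTheorem4 τ e)
                                            (Body-exts C v env λ {τ} → mainTheorem4 τ f)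
mainTheorem4 σ (⊢⊕ {A = A} {B} d e) env = reducible-⊙-⊕ A B (mainTheorem4 σ d env) (mainTheorem4 σ e env)
mainTheorem4 σ (⊢δ⊙ {u = u} {v} {A} {B} {C} d e f) env =
  reducible-δ⊙ A B C (mainTheorem4 σ d env) (Body-exts C u env λ {τ} → mainTheorem4 τ e)
                                            (Body-exts C v env λ {τ} → mainTheorem4 τ f)
mainTheorem4 σ (⊢δ⊙∥ {u = u} {v} {A} {B} {C} d e f) env =
  reducible-δ⊙∥ A B C (mainTheorem4 σ d env) (Body-exts C u env λ {τ} → mainTheorem4 τ e)
                                              (Body-exts C v env λ {τ} → mainTheorem4 τ f)
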